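{- Let $\lambda,\mu,\nu,\alpha,\beta,\gamma\vdash n$ be partitions with $\ell(\lambda)=\ell(\alpha)$, $\ell(\mu)=\ell(\beta)$, $\ell(\nu)=\ell(\gamma)$, and suppose $\lambda\trianglerighteq\alpha$, $\mu\trianglerighteq\beta$, $\nu\trianglerighteq\gamma$. Then $\mathrm{T}(\lambda,\mu,\nu)\le \mathrm{T}(\alpha,\beta,\gamma)$.
   Context: $\ell(\lambda)$ is the number of parts of a partition $\lambda$. Dominance order: for $\lambda,\mu\vdash n$, $\lambda\trianglerighteq\mu$ means $\lambda_1+\dots+\lambda_i\ge\mu_1+\dots+\mu_i$ for all $i$ (parts beyond the length being $0$). For $\lambda,\mu,\nu\vdash n$, $\mathrm{T}(\lambda,\mu,\nu)$ is the number of three-dimensional contingency tables with these margins, i.e. arrays $(x_{ijk})$ of nonnegative integers, $1\le i\le\ell(\lambda)$, $1\le j\le \ell(\mu)$, $1\le k\le\ell(\nu)$, with $\sum_{j,k}x_{ijk}=\lambda_i$, $\sum_{i,k}x_{ijk}=\mu_j$, $\sum_{i,j}x_{ijk}=\nu_k$ for all $i,j,k$. -}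

module Defs where

open import Data.Nat using (ℕ; zero; suc; _+_; _≤_; _≥_; _<_; _≟_)
open import Data.Nat.ListAction using (sum)
open import Data.List using (List; []; _∷_; length; take; map; concatMap; filter; upTo)
open import Data.List.Relation.Unary.All using (All)
open import Data.List.Relation.Unary.Linked using (Linked)
open import Data.Vec using (Vec; []; _∷_; toList; foldr; zipWith; replicate)
open import Data.Product using (_×_; _,_)
open import Relation.Binary.PropositionalEquality using (_≡_)
open import Relation.Nullary using (Dec)
open import Data.Vec.Properties using () renaming (≡-dec to vec-≡-dec)
open import Relation.Nullary.Decidable using (_×-dec_)

record Partition (n : ℕ) : Set where
  constructor mkPartition
  field
    parts    : List ℕ
    positive : All (λ x → 0 < x) parts
    decr     : Linked _≥_ parts
    total    : sum parts ≡ n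

open Partition public

ℓ : ∀ {n} → Partition n → ℕ
ℓ p = length (parts p)

-- Dominance order: λ ⊵ μ iff for all i, λ₁+…+λᵢ ≥ μ₁+…+μᵢ
-- (take i of a list pads implicitly with zeros beyond its length).
_⊵_ : ∀ {n} → Partition n → Partition n → Set
lam ⊵ mu = ∀ (i : ℕ) → sum (take i (parts lam)) ≥ sum (take i (parts mu))

Table : ℕ → ℕ → ℕ → Set
Table a b c = Vec (Vec (Vec ℕ c) b) a

vsum : ∀ {m} → Vec ℕ m → ℕ
vsum = foldr _ _+_ 0

vadd : ∀ {m} → Vec ℕ m → Vec ℕ m → Vec ℕ m
vadd = zipWith _+_

vzero : ∀ {m} → Vec ℕ m
vzero = replicate _ 0

margin₁ : ∀ {a b c} → Table a b c → Vec ℕ a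
margin₁ [] = []
margin₁ (s ∷ t) = vsum (Data.Vec.map vsum s) ∷ margin₁ t

margin₂ : ∀ {a b c} → Table a b c → Vec ℕ b
margin₂ [] = vzero
margin₂ (s ∷ t) = vadd (Data.Vec.map vsum s) (margin₂ t)

sliceSum : ∀ {b c} → Vec (Vec ℕ c) b → Vec ℕ c
sliceSum [] = vzero
sliceSum (r ∷ s) = vadd r (sliceSum s)

margin₃ : ∀ {a b c} → Table a b c → Vec ℕ c
margin₃ [] = vzero
margin₃ (s ∷ t) = vadd (sliceSum s) (margin₃ t)

allVecsOf : ∀ {A : Set} → List A → (m : ℕ) → List (Vec A m)
allVecsOf xs zero = [] ∷ []
allVecsOf xs (suc m) = concatMap (λ x → map (x ∷_) (allVecsOf xs m)) xs

allVecs : (N m : ℕ) → List (Vec ℕ m)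
allVecs N m = allVecsOf (upTo (suc N)) m

allTables : (N a b c : ℕ) → List (Table a b c)
allTables N a b c = allVecsOf (allVecsOf (allVecs N c) b) a

HasMargins : ∀ {a b c} → Vec ℕ a → Vec ℕ b → Vec ℕ c → Table a b c → Set
HasMargins r s t x = (margin₁ x ≡ r × margin₂ x ≡ s) × margin₃ x ≡ t

hasMargins? : ∀ {a b c} (r : Vec ℕ a) (s : Vec ℕ b) (t : Vec ℕ c) (x : Table a b c) →
              Dec (HasMargins r s t x)
hasMargins? r s t x =
  (vec-≡-dec _≟_ (margin₁ x) r ×-dec vec-≡-dec _≟_ (margin₂ x) s) ×-dec vec-≡-dec _≟_ (margin₃ x) t

-- Every entry of such a
-- table is at most n (it is bounded by the total Σ λᵢ = n), so enumerating tables
-- with entries in {0,…,n} counts all of them, each exactly once.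
T : ∀ {n} → Partition n → Partition n → Partition n → ℕ
T {n} lam mu nu =
  length (filter (hasMargins? (Data.Vec.fromList (parts lam))
                              (Data.Vec.fromList (parts mu))
                              (Data.Vec.fromList (parts nu)))
                 (allTables n (ℓ lam) (ℓ mu) (ℓ nu)))

-- Fix the column and layer margins and move one unit of row margin from a row p to a row q with a
-- smaller margin. Sum first over the entries outside rows p and q; what remains is a count over the
-- cells (p, j, k), (q, j, k), which, as a function of the margins x, y still to be met in rows p and q,
-- is symmetric and increases towards x = y along each line x + y = const. This property survives each
-- pair of cells added, because adding a pair convolves the count with a function of the same kind,
-- so the move cannot decrease the number of tables. If λ ⊵ α and ℓ(λ) = ℓ(α), then α is reached from
-- λ by such moves; permuting the three axes handles μ and ν.

module Submission where

open import Defs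
open import Data.Nat using (ℕ; zero; suc; z≤n; s≤s; _≤_; _<_; _≥_; _∸_; pred; _<?_; _≤?_)
  renaming (_+_ to _+ℕ_)
import Data.Nat.Properties as ℕ
open import Data.Nat.ListAction using (sum)
open import Data.Integer using (ℤ; +_; -_; _-_; 0ℤ; 1ℤ)
import Data.Integer.Properties as ℤ
open import Data.Fin using (Fin; zero; suc; toℕ)
import Data.Fin.Properties as Fin
open import Data.Vec as V using (Vec; []; _∷_; lookup; replicate; zipWith; updateAt; toList; fromList)
import Data.Vec.Properties as Vec
open import Data.List as List
  using ( List; []; _∷_; _++_; map; concatMap; concat; length; filter; take
        ; applyUpTo; upTo; tabulate; allFin; cartesianProduct)
import Data.List.Properties as List
open import Data.List.Membership.Propositional using (_∈_)
open import Data.List.Membership.Propositional.Properties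
  using ( ∈-filter⁺; ∈-filter⁻; ∈-allFin; ∈-cartesianProduct⁺; ∈-cartesianProduct⁻
        ; ∈-++⁺ˡ; ∈-++⁺ʳ; ∈-map⁺)
open import Data.List.Membership.Propositional.Properties.WithK using (unique∧set⇒bag)
open import Data.List.Relation.Binary.BagAndSetEquality using (∼bag⇒↭)
open import Data.List.Relation.Binary.Permutation.Propositional as ↭ using (_↭_)
import Data.List.Relation.Binary.Permutation.Propositional.Properties as ↭
open import Data.List.Relation.Unary.All using ([]; _∷_)
open import Data.List.Relation.Unary.AllPairs using ([]; _∷_)
open import Data.List.Relation.Unary.Any using (here; there)
open import Data.List.Relation.Unary.Linked as Linked using (Linked; _∷_)
open import Data.List.Relation.Unary.Unique.Propositional using (Unique)
import Data.List.Relation.Unary.Unique.Propositional.Properties as Unique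
open import Data.Product using (_×_; _,_; proj₁; proj₂; ∃-syntax)
import Data.Product.Properties as Product
open import Data.Sum using (inj₁; inj₂)
open import Data.Empty using (⊥-elim)
open import Function using (id; _∘_; const)
open import Function.Bundles using (mk⇔)
open import Relation.Nullary using (Dec; yes; no; ¬_; ¬?)
open import Relation.Nullary.Decidable using (_×-dec_)
open import Relation.Binary.PropositionalEquality

module FiniteSums where
  open import Data.Nat using (_+_)
  open import Algebra.Properties.CommutativeSemigroup ℕ.+-commutativeSemigroup
    using () renaming (interchange to +-interchange)

  ∑< : ℕ → (ℕ → ℕ) → ℕ
  ∑< zero    f = 0
  ∑< (suc n) f = f 0 + ∑< n (f ∘ suc)

  syntax ∑< n (λ u → e) = ∑[ u < n ] e

  ∑-cong : ∀ n {f g : ℕ → ℕ} → (∀ u → f u ≡ g u) → ∑< n f ≡ ∑< n g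
  ∑-cong zero    f≡g = refl
  ∑-cong (suc n) f≡g = cong₂ _+_ (f≡g 0) (∑-cong n (f≡g ∘ suc))

  ∑-mono : ∀ n {f g : ℕ → ℕ} → (∀ u → u < n → f u ≤ g u) → ∑< n f ≤ ∑< n g
  ∑-mono zero    f≤g = z≤n
  ∑-mono (suc n) f≤g = ℕ.+-mono-≤ (f≤g 0 (s≤s z≤n)) (∑-mono n (λ u u<n → f≤g (suc u) (s≤s u<n)))

  ∑-zero : ∀ n → ∑< n (const 0) ≡ 0
  ∑-zero zero    = refl
  ∑-zero (suc n) = ∑-zero n

  ∑-distrib-+ : ∀ n (f g : ℕ → ℕ) → ∑[ u < n ] (f u + g u) ≡ ∑< n f + ∑< n g
  ∑-distrib-+ zero    f g = refl
  ∑-distrib-+ (suc n) f g = trans (cong (_+_ (f 0 + g 0)) (∑-distrib-+ n (f ∘ suc) (g ∘ suc)))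
                                  (+-interchange (f 0) (g 0) _ _)

  ∑-snoc : ∀ n (f : ℕ → ℕ) → ∑< (suc n) f ≡ ∑< n f + f n
  ∑-snoc zero    f = ℕ.+-comm (f 0) 0
  ∑-snoc (suc n) f = trans (cong (_+_ (f 0)) (∑-snoc n (f ∘ suc))) (sym (ℕ.+-assoc (f 0) _ _))

  ∑-comm : ∀ m n (f : ℕ → ℕ → ℕ) → ∑[ u < m ] ∑< n (f u) ≡ ∑[ w < n ] ∑[ u < m ] f u w
  ∑-comm zero    n f = sym (∑-zero n)
  ∑-comm (suc m) n f = trans (cong (_+_ (∑< n (f 0))) (∑-comm m n (f ∘ suc)))
                             (sym (∑-distrib-+ n (f 0) (λ w → ∑[ u < m ] f (suc u) w)))

  iverson : ∀ {P : Set} → Dec P → ℕ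
  iverson (yes _) = 1
  iverson (no  _) = 0

  iverson-cong : ∀ {P Q : Set} (p : Dec P) (q : Dec Q) → (P → Q) → (Q → P) → iverson p ≡ iverson q
  iverson-cong (yes _) (yes _) _   _   = refl
  iverson-cong (yes p) (no ¬q) p→q _   = ⊥-elim (¬q (p→q p))
  iverson-cong (no ¬p) (yes q) _   q→p = ⊥-elim (¬p (q→p q))
  iverson-cong (no _)  (no _)  _   _   = refl

  ∑∈ : ∀ {A : Set} → (A → ℕ) → List A → ℕ
  ∑∈ f []       = 0
  ∑∈ f (x ∷ xs) = f x + ∑∈ f xs

  ∑∈-cong : ∀ {A : Set} {f g : A → ℕ} xs → (∀ x → f x ≡ g x) → ∑∈ f xs ≡ ∑∈ g xs
  ∑∈-cong []       f≡g = refl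
  ∑∈-cong (x ∷ xs) f≡g = cong₂ _+_ (f≡g x) (∑∈-cong xs f≡g)

  ∑∈-++ : ∀ {A : Set} (f : A → ℕ) xs ys → ∑∈ f (xs ++ ys) ≡ ∑∈ f xs + ∑∈ f ys
  ∑∈-++ f []       ys = refl
  ∑∈-++ f (x ∷ xs) ys = trans (cong (_+_ (f x)) (∑∈-++ f xs ys)) (sym (ℕ.+-assoc (f x) _ _))

  ∑∈-map : ∀ {A B : Set} (f : B → ℕ) (g : A → B) xs → ∑∈ f (map g xs) ≡ ∑∈ (f ∘ g) xs
  ∑∈-map f g []       = refl
  ∑∈-map f g (x ∷ xs) = cong (_+_ (f (g x))) (∑∈-map f g xs)

  ∑∈-concatMap : ∀ {A B : Set} (f : B → ℕ) (g : A → List B) xs →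
                 ∑∈ f (concatMap g xs) ≡ ∑∈ (∑∈ f ∘ g) xs
  ∑∈-concatMap f g []       = refl
  ∑∈-concatMap f g (x ∷ xs) =
    trans (∑∈-++ f (g x) (concat (map g xs))) (cong (_+_ (∑∈ f (g x))) (∑∈-concatMap f g xs))

  ∑∈-applyUpTo : ∀ (f h : ℕ → ℕ) n → ∑∈ f (applyUpTo h n) ≡ ∑< n (f ∘ h)
  ∑∈-applyUpTo f h zero    = refl
  ∑∈-applyUpTo f h (suc n) = cong (_+_ (f (h 0))) (∑∈-applyUpTo f (h ∘ suc) n)

  ∑∈-allVecsOf : ∀ {A : Set} (xs : List A) m (f : Vec A (suc m) → ℕ) →
                 ∑∈ f (allVecsOf xs (suc m)) ≡ ∑∈ (λ x → ∑∈ (f ∘ (x ∷_)) (allVecsOf xs m)) xs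
  ∑∈-allVecsOf xs m f = trans (∑∈-concatMap f (λ x → map (x ∷_) (allVecsOf xs m)) xs)
                              (∑∈-cong xs (λ x → ∑∈-map f (x ∷_) (allVecsOf xs m)))

  length-filter : ∀ {A : Set} {P : A → Set} (P? : ∀ x → Dec (P x)) xs →
                  length (filter P? xs) ≡ ∑∈ (iverson ∘ P?) xs
  length-filter P? []       = refl
  length-filter P? (x ∷ xs) with P? x
  ... | yes _ = cong suc (length-filter P? xs)
  ... | no  _ = length-filter P? xs

open FiniteSums

module Unimodality where
  open import Data.Integer using (_+_)
  open import Data.Integer.Tactic.RingSolver using (solve-∀)
  open import Algebra.Properties.CommutativeSemigroup ℕ.+-commutativeSemigroup
    using () renaming (interchange to +-interchange)

  -- F is symmetric and, along each antidiagonal x + y = const, nondecreasing towards the diagonal.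
  record Unimodal (F : ℤ → ℤ → ℕ) : Set where
    field
      symmetric : ∀ x y → F x y ≡ F y x
      climb     : ∀ y k → F ((y + + k) + 1ℤ) y ≤ F (y + + k) (y + 1ℤ)

    climbs : ∀ l d y → F (y + + l + + l + + d) y ≤ F (y + + l + + d) (y + + l)
    climbs zero    d y =
      ℕ.≤-reflexive (cong₂ F (cong (_+ + d) (ℤ.+-identityʳ (y + 0ℤ))) (sym (ℤ.+-identityʳ y)))
    climbs (suc l) d y = begin
      F (y + + suc l + + suc l + + d) y           ≡⟨ cong (λ x → F x y) (eq₁ y (+ l) (+ d)) ⟩
      F (y + + l + + l + + (2 +ℕ d)) y            ≤⟨ climbs l (2 +ℕ d) y ⟩
      F (y + + l + + (2 +ℕ d)) (y + + l)          ≡⟨ cong (λ x → F x (y + + l)) (eq₂ y (+ l) (+ d)) ⟩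
      F ((y + + l) + + suc d + 1ℤ) (y + + l)      ≤⟨ climb (y + + l) (suc d) ⟩
      F ((y + + l) + + suc d) ((y + + l) + 1ℤ)    ≡⟨ cong₂ F (eq₃ y (+ l) (+ d)) (eq₄ y (+ l)) ⟩
      F (y + + suc l + + d) (y + + suc l)         ∎
      where
      open ℕ.≤-Reasoning
      eq₁ : ∀ y l d → y + (1ℤ + l) + (1ℤ + l) + d ≡ y + l + l + (+ 2 + d)
      eq₁ = solve-∀
      eq₂ : ∀ y l d → y + l + (+ 2 + d) ≡ (y + l) + (1ℤ + d) + 1ℤ
      eq₂ = solve-∀
      eq₃ : ∀ y l d → (y + l) + (1ℤ + d) ≡ y + (1ℤ + l) + d
      eq₃ = solve-∀
      eq₄ : ∀ y l → (y + l) + 1ℤ ≡ y + (1ℤ + l)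
      eq₄ = solve-∀

    towards-diagonal : ∀ y l k → F ((y + + l) + + k) y ≤ F (y + + k) (y + + l)
    towards-diagonal y l k with ℕ.≤-total l k
    ... | inj₁ l≤k with d , refl ← ℕ.m≤n⇒∃[o]m+o≡n l≤k =
      subst₂ _≤_ (cong (λ x → F x y) (eq₁ y (+ l) (+ d)))
                 (cong (λ x → F x (y + + l)) (ℤ.+-assoc y (+ l) (+ d)))
                 (climbs l d y)
      where
      eq₁ : ∀ y l d → y + l + l + d ≡ (y + l) + (l + d)
      eq₁ = solve-∀
    ... | inj₂ k≤l with d , refl ← ℕ.m≤n⇒∃[o]m+o≡n k≤l =
      subst₂ _≤_ (cong (λ x → F x y) (eq₁ y (+ k) (+ d)))
                 (trans (symmetric _ _) (cong (F (y + + k)) (ℤ.+-assoc y (+ k) (+ d))))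
                 (climbs k d y)
      where
      eq₁ : ∀ y k d → y + k + k + d ≡ (y + (k + d)) + k
      eq₁ = solve-∀

  open Unimodal

  unimodal-resp : ∀ {F G} → Unimodal F → (∀ x y → F x y ≡ G x y) → Unimodal G
  unimodal-resp {F} {G} F-unimodal F≡G = record
    { symmetric = λ x y → trans (sym (F≡G x y)) (trans (symmetric F-unimodal x y) (F≡G y x))
    ; climb     = λ y k → subst₂ _≤_ (F≡G _ _) (F≡G _ _) (climb F-unimodal y k)
    }

  module _ (N : ℕ) (G : ℕ → ℤ → ℤ → ℕ) (G-unimodal : ∀ m → Unimodal (G m)) where

    convolution : ℤ → ℤ → ℕ
    convolution x y = ∑[ u < suc N ] ∑[ w < suc N ] G (u +ℕ w) (x - + u) (y - + w)

    convolution-symmetric : ∀ x y → convolution x y ≡ convolution y x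
    convolution-symmetric x y = begin
      ∑[ u < suc N ] ∑[ w < suc N ] G (u +ℕ w) (x - + u) (y - + w)
        ≡⟨ ∑-comm (suc N) (suc N) (λ u w → G (u +ℕ w) (x - + u) (y - + w)) ⟩
      ∑[ w < suc N ] ∑[ u < suc N ] G (u +ℕ w) (x - + u) (y - + w)
        ≡⟨ ∑-cong (suc N) (λ w → ∑-cong (suc N) (λ u → swap-cells u w)) ⟩
      ∑[ w < suc N ] ∑[ u < suc N ] G (w +ℕ u) (y - + w) (x - + u)   ∎
      where
      open ≡-Reasoning
      swap-cells : ∀ u w → G (u +ℕ w) (x - + u) (y - + w) ≡ G (w +ℕ u) (y - + w) (x - + u)
      swap-cells u w = trans (cong (λ m → G m (x - + u) (y - + w)) (ℕ.+-comm u w)) (symmetric (G-unimodal _) _ _)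

    -- With x = y + k, a u w and b u w are the summands of convolution (x + 1) y and convolution x (y + 1).
    -- Since b u (1 + w) = a (1 + u) w, both double sums contain the block C; the remaining boundary
    -- terms are compared one by one with towards-diagonal.
    convolution-climb : ∀ y k → convolution ((y + + k) + 1ℤ) y ≤ convolution (y + + k) (y + 1ℤ)
    convolution-climb y k = begin
      convolution (x + 1ℤ) y     ≡⟨ split-a ⟩
      (P +ℕ C) +ℕ (a 0 N +ℕ Q)   ≡⟨ +-interchange P C (a 0 N) Q ⟩
      (P +ℕ a 0 N) +ℕ (C +ℕ Q)   ≤⟨ ℕ.+-mono-≤ (ℕ.+-mono-≤ P≤R (a≤b 0 N)) (ℕ.+-monoʳ-≤ C Q≤S) ⟩
      (R +ℕ b N 0) +ℕ (C +ℕ S)   ≡⟨ split-b ⟨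
      convolution x (y + 1ℤ)     ∎
      where
      open ℕ.≤-Reasoning
      x = y + + k
      a b : ℕ → ℕ → ℕ
      a u w = G (u +ℕ w) ((x + 1ℤ) - + u) (y - + w)
      b u w = G (u +ℕ w) (x - + u) ((y + 1ℤ) - + w)
      P Q R S C : ℕ
      P = ∑< N (a 0)
      Q = ∑[ u < N ] a (suc u) N
      R = ∑[ u < N ] b u 0
      S = ∑[ w < N ] b N (suc w)
      C = ∑[ u < N ] ∑< N (a (suc u))

      b-shift : ∀ u w → b u (suc w) ≡ a (suc u) w
      b-shift u w = trans (cong (λ m → G m (x - + u) ((y + 1ℤ) - + suc w)) (ℕ.+-suc u w))
                          (cong₂ (G _) (eq₁ x (+ u)) (eq₂ y (+ w)))
        where
        eq₁ : ∀ x u → x - u ≡ (x + 1ℤ) - (1ℤ + u)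
        eq₁ = solve-∀
        eq₂ : ∀ y w → (y + 1ℤ) - (1ℤ + w) ≡ y - w
        eq₂ = solve-∀

      split-a : convolution (x + 1ℤ) y ≡ (P +ℕ C) +ℕ (a 0 N +ℕ Q)
      split-a = trans (∑-cong (suc N) (λ u → ∑-snoc N (a u)))
                      (∑-distrib-+ (suc N) (λ u → ∑< N (a u)) (λ u → a u N))

      split-b : convolution x (y + 1ℤ) ≡ (R +ℕ b N 0) +ℕ (C +ℕ S)
      split-b = trans (∑-distrib-+ (suc N) (λ u → b u 0) (λ u → ∑[ w < N ] b u (suc w)))
                      (cong₂ _+ℕ_ (∑-snoc N (λ u → b u 0))
                                  (trans (∑-snoc N (λ u → ∑[ w < N ] b u (suc w)))
                                         (cong (_+ℕ S) (∑-cong N (λ u → ∑-cong N (b-shift u))))))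

      a≤b : ∀ u l → a u (u +ℕ l) ≤ b (u +ℕ l) u
      a≤b u l = subst₂ _≤_ (cong (λ z → G m z y′) (eq₁ y (+ u) (+ l) (+ k)))
                           (trans (cong (λ m → G m (y′ + + k) (y′ + + suc l)) (ℕ.+-comm u (u +ℕ l)))
                                  (cong₂ (G (u +ℕ l +ℕ u)) (eq₂ y (+ u) (+ l) (+ k)) (eq₃ y (+ u) (+ l))))
                           (towards-diagonal (G-unimodal m) y′ (suc l) k)
        where
        m = u +ℕ (u +ℕ l)
        y′ = y - + (u +ℕ l)
        eq₁ : ∀ y u l k → (y - (u + l) + (1ℤ + l)) + k ≡ (y + k + 1ℤ) - u
        eq₁ = solve-∀
        eq₂ : ∀ y u l k → (y - (u + l)) + k ≡ (y + k) - (u + l)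
        eq₂ = solve-∀
        eq₃ : ∀ y u l → (y - (u + l)) + (1ℤ + l) ≡ (y + 1ℤ) - u
        eq₃ = solve-∀

      P≤R : P ≤ R
      P≤R = ∑-mono N (λ w _ → a≤b 0 w)

      Q≤S : Q ≤ S
      Q≤S = ∑-mono N (λ u u<N → subst (λ n → a (suc u) n ≤ b n (suc u)) (ℕ.m+[n∸m]≡n u<N)
                                      (a≤b (suc u) (N ∸ suc u)))

    convolution-unimodal : Unimodal convolution
    convolution-unimodal = record { symmetric = convolution-symmetric ; climb = convolution-climb }

open Unimodality

module MarginVectors where
  open import Data.Integer using (_+_)

  addAt : ∀ {a} → Fin a → ℤ → Vec ℤ a → Vec ℤ a
  addAt i z v = updateAt v i (λ x → z + x)

  addAt-addAt : ∀ {a} (i : Fin a) z w v → addAt i z (addAt i w v) ≡ addAt i (z + w) v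
  addAt-addAt i z w v = Vec.updateAt-updateAt-local i v (sym (ℤ.+-assoc z w _))

  addAt-comm : ∀ {a} (i j : Fin a) z w v → addAt i z (addAt j w v) ≡ addAt j w (addAt i z v)
  addAt-comm i j z w v with i Fin.≟ j
  ... | yes refl = trans (addAt-addAt i z w v)
                         (trans (cong (λ s → addAt i s v) (ℤ.+-comm z w)) (sym (addAt-addAt i w z v)))
  ... | no  i≢j  = Vec.updateAt-commutes i j i≢j v

  addAt-0 : ∀ {a} (i : Fin a) v → addAt i 0ℤ v ≡ v
  addAt-0 i v = Vec.updateAt-id-local i v (ℤ.+-identityˡ _)

  lookup-addAt : ∀ {a} (i : Fin a) z v → lookup (addAt i z v) i ≡ z + lookup v i
  lookup-addAt i z v = Vec.lookup∘updateAt i v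

  lookup-addAt-≢ : ∀ {a} (i j : Fin a) z v → i ≢ j → lookup (addAt j z v) i ≡ lookup v i
  lookup-addAt-≢ i j z v i≢j = Vec.lookup∘updateAt′ i j i≢j v

  -- Integer-valued, so that margins can be shifted by negative amounts.
  Margins : ℕ → ℕ → ℕ → Set
  Margins a b c = Vec ℤ a × Vec ℤ b × Vec ℤ c

  Cell : ℕ → ℕ → ℕ → Set
  Cell a b c = Fin a × Fin b × Fin c

  noMargins : ∀ {a b c} → Margins a b c
  noMargins = replicate _ 0ℤ , replicate _ 0ℤ , replicate _ 0ℤ

  place : ∀ {a b c} → Cell a b c → ℕ → Margins a b c → Margins a b c
  place (i , j , k) v (r , s , t) = addAt i (+ v) r , addAt j (+ v) s , addAt k (+ v) t

  place-comm : ∀ {a b c} (x y : Cell a b c) v w m → place y w (place x v m) ≡ place x v (place y w m)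
  place-comm (i , j , k) (i′ , j′ , k′) v w (r , s , t) =
    cong₂ _,_ (addAt-comm i′ i (+ w) (+ v) r)
              (cong₂ _,_ (addAt-comm j′ j (+ w) (+ v) s) (addAt-comm k′ k (+ w) (+ v) t))

  _≟ᴹ_ : ∀ {a b c} (m m′ : Margins a b c) → Dec (m ≡ m′)
  _≟ᴹ_ = Product.≡-dec (Vec.≡-dec ℤ._≟_) (Product.≡-dec (Vec.≡-dec ℤ._≟_) (Vec.≡-dec ℤ._≟_))

  δ : ∀ {a b c} → Margins a b c → Margins a b c → ℕ
  δ T m = iverson (m ≟ᴹ T)

  δ-≢ : ∀ {a b c} (T m : Margins a b c) → m ≢ T → δ T m ≡ 0
  δ-≢ T m m≢T with m ≟ᴹ T
  ... | yes m≡T = ⊥-elim (m≢T m≡T)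
  ... | no  _   = refl

  δ-cong : ∀ {a b c a′ b′ c′} (T m : Margins a b c) (T′ m′ : Margins a′ b′ c′) →
           (m ≡ T → m′ ≡ T′) → (m′ ≡ T′ → m ≡ T) → δ T m ≡ δ T′ m′
  δ-cong T m T′ m′ = iverson-cong (m ≟ᴹ T) (m′ ≟ᴹ T′)

  toℤ : ∀ {n} → Vec ℕ n → Vec ℤ n
  toℤ = V.map (λ v → + v)

  toℤ-injective : ∀ {n} (u v : Vec ℕ n) → toℤ u ≡ toℤ v → u ≡ v
  toℤ-injective []      []      _ = refl
  toℤ-injective (x ∷ u) (y ∷ v) e =
    cong₂ _∷_ (ℤ.+-injective (cong V.head e)) (toℤ-injective u v (cong V.tail e))

  infixl 6 _⊕_
  _⊕_ : ∀ {n} → Vec ℤ n → Vec ℕ n → Vec ℤ n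
  _⊕_ = zipWith (λ z v → z + + v)

  ⊕-identityʳ : ∀ {n} (u : Vec ℤ n) → u ⊕ vzero ≡ u
  ⊕-identityʳ []      = refl
  ⊕-identityʳ (x ∷ u) = cong₂ _∷_ (ℤ.+-identityʳ x) (⊕-identityʳ u)

  ⊕-assoc : ∀ {n} (u : Vec ℤ n) (v w : Vec ℕ n) → u ⊕ v ⊕ w ≡ u ⊕ vadd v w
  ⊕-assoc []      []      []      = refl
  ⊕-assoc (x ∷ u) (y ∷ v) (z ∷ w) = cong₂ _∷_ (ℤ.+-assoc x (+ y) (+ z)) (⊕-assoc u v w)

  0⊕ : ∀ {n} (v : Vec ℕ n) → replicate n 0ℤ ⊕ v ≡ toℤ v
  0⊕ []      = refl
  0⊕ (x ∷ v) = cong₂ _∷_ (ℤ.+-identityˡ (+ x)) (0⊕ v)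

  cons₁ : ∀ {a b c} → ℤ → Margins a b c → Margins (suc a) b c
  cons₁ x (r , s , t) = x ∷ r , s , t

  cons₂ : ∀ {a b c} → ℤ → Margins a b c → Margins a (suc b) c
  cons₂ x (r , s , t) = r , x ∷ s , t

  cons₃ : ∀ {a b c} → ℤ → Margins a b c → Margins a b (suc c)
  cons₃ x (r , s , t) = r , s , x ∷ t

  move : ∀ {a} → Fin a → Fin a → Vec ℕ a → Vec ℕ a
  move p q v = updateAt (updateAt v p pred) q suc

  toℤ-move : ∀ {a} (p q : Fin a) v → 1 ≤ lookup v p →
             toℤ (move p q v) ≡ addAt p (- 1ℤ) (addAt q 1ℤ (toℤ v))
  toℤ-move p q v 1≤vp = begin
    toℤ (updateAt (updateAt v p pred) q suc)  ≡⟨ Vec.map-updateAt (updateAt v p pred) q refl ⟩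
    addAt q 1ℤ (toℤ (updateAt v p pred))     ≡⟨ cong (addAt q 1ℤ) (Vec.map-updateAt v p (+pred 1≤vp)) ⟩
    addAt q 1ℤ (addAt p (- 1ℤ) (toℤ v))      ≡⟨ addAt-comm q p 1ℤ (- 1ℤ) (toℤ v) ⟩
    addAt p (- 1ℤ) (addAt q 1ℤ (toℤ v))      ∎
    where
    open ≡-Reasoning
    +pred : ∀ {x} → 1 ≤ x → + pred x ≡ - 1ℤ + + x
    +pred (s≤s _) = refl

open MarginVectors

IsEnumeration : ∀ {A : Set} → List A → Set
IsEnumeration xs = Unique xs × (∀ x → x ∈ xs)

enumeration-↭ : ∀ {A : Set} {xs ys : List A} → IsEnumeration xs → IsEnumeration ys → xs ↭ ys
enumeration-↭ (xs-unique , xs-complete) (ys-unique , ys-complete) =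
  ∼bag⇒↭ (unique∧set⇒bag xs-unique ys-unique (λ {x} → mk⇔ (λ _ → ys-complete x) (λ _ → xs-complete x)))

map-enumeration : ∀ {A B : Set} (f : A → B) (g : B → A) → (∀ x → g (f x) ≡ x) → (∀ y → f (g y) ≡ y) →
                  ∀ {xs} → IsEnumeration xs → IsEnumeration (map f xs)
map-enumeration f g gf fg (xs-unique , xs-complete) =
    Unique.map⁺ (λ {x} {y} fx≡fy → trans (sym (gf x)) (trans (cong g fx≡fy) (gf y))) xs-unique
  , λ y → subst (_∈ map f _) (fg y) (∈-map⁺ f (xs-complete (g y)))

swap₁₂ : ∀ {A B C : Set} → A × B × C → B × A × C
swap₁₂ (x , y , z) = y , x , z

swap₁₃ : ∀ {A B C : Set} → A × B × C → C × B × A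
swap₁₃ (x , y , z) = z , y , x

module Filling (N : ℕ) where

  ∑fill : ∀ {a b c} → List (Cell a b c) → (Margins a b c → ℕ) → Margins a b c → ℕ
  ∑fill []       f m = f m
  ∑fill (x ∷ xs) f m = ∑[ v < suc N ] ∑fill xs f (place x v m)

  ∑fill-cong : ∀ {a b c} (xs : List (Cell a b c)) {f g} → (∀ m → f m ≡ g m) →
               ∀ m → ∑fill xs f m ≡ ∑fill xs g m
  ∑fill-cong []       f≡g m = f≡g m
  ∑fill-cong (x ∷ xs) f≡g m = ∑-cong (suc N) (λ v → ∑fill-cong xs f≡g (place x v m))

  ∑fill-mono : ∀ {a b c} (I : Margins a b c → Set) (xs : List (Cell a b c)) {f g} →
               (∀ x → x ∈ xs → ∀ v m → I m → I (place x v m)) →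
               (∀ m → I m → f m ≤ g m) → ∀ m → I m → ∑fill xs f m ≤ ∑fill xs g m
  ∑fill-mono I []       preserves f≤g m i = f≤g m i
  ∑fill-mono I (x ∷ xs) preserves f≤g m i = ∑-mono (suc N) (λ v _ →
    ∑fill-mono I xs (λ y y∈xs → preserves y (there y∈xs)) f≤g (place x v m) (preserves x (here refl) v m i))

  ∑fill-++ : ∀ {a b c} (xs ys : List (Cell a b c)) f m → ∑fill (xs ++ ys) f m ≡ ∑fill xs (∑fill ys f) m
  ∑fill-++ []       ys f m = refl
  ∑fill-++ (x ∷ xs) ys f m = ∑-cong (suc N) (λ v → ∑fill-++ xs ys f (place x v m))

  ∑fill-↭ : ∀ {a b c} {xs ys : List (Cell a b c)} → xs ↭ ys → ∀ f m → ∑fill xs f m ≡ ∑fill ys f m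
  ∑fill-↭ ↭.refl              f m = refl
  ∑fill-↭ (↭.prep x xs↭ys)    f m = ∑-cong (suc N) (λ v → ∑fill-↭ xs↭ys f (place x v m))
  ∑fill-↭ (↭.swap {xs} {ys} x y xs↭ys) f m =
    trans (∑-comm (suc N) (suc N) (λ v w → ∑fill xs f (place y w (place x v m))))
          (∑-cong (suc N) (λ w → ∑-cong (suc N) (λ v →
            trans (cong (∑fill xs f) (place-comm x y v w m)) (∑fill-↭ xs↭ys f (place x v (place y w m))))))
  ∑fill-↭ (↭.trans xs↭ys ys↭zs) f m = trans (∑fill-↭ xs↭ys f m) (∑fill-↭ ys↭zs f m)

  ∑fill-map : ∀ {a b c a′ b′ c′} (σ : Cell a b c → Cell a′ b′ c′)
              (g : Margins a b c → Margins a′ b′ c′) →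
              (∀ x v m → place (σ x) v (g m) ≡ g (place x v m)) →
              ∀ (xs : List (Cell a b c)) f m → ∑fill (map σ xs) f (g m) ≡ ∑fill xs (f ∘ g) m
  ∑fill-map σ g place-σ []       f m = refl
  ∑fill-map σ g place-σ (x ∷ xs) f m =
    ∑-cong (suc N) (λ v → trans (cong (∑fill (map σ xs) f) (place-σ x v m))
                                (∑fill-map σ g place-σ xs f (place x v m)))

module Transfer (N : ℕ) {a b c : ℕ} (p q : Fin a) (p≢q : p ≢ q) where
  open import Data.Integer using (_+_)
  open import Data.Integer.Tactic.RingSolver using (solve-∀)
  open Unimodal using (climb)
  open Filling N

  shiftPQ : ℤ → ℤ → Margins a b c → Margins a b c
  shiftPQ x y (r , st) = addAt p x (addAt q y r) , st

  shiftPQ-shiftPQ : ∀ x y x′ y′ m → shiftPQ x y (shiftPQ x′ y′ m) ≡ shiftPQ (x + x′) (y + y′) m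
  shiftPQ-shiftPQ x y x′ y′ (r , st) = cong (_, st) (begin
    addAt p x (addAt q y (addAt p x′ (addAt q y′ r)))   ≡⟨ cong (addAt p x) (addAt-comm q p y x′ _) ⟩
    addAt p x (addAt p x′ (addAt q y (addAt q y′ r)))   ≡⟨ addAt-addAt p x x′ _ ⟩
    addAt p (x + x′) (addAt q y (addAt q y′ r))         ≡⟨ cong (addAt p (x + x′)) (addAt-addAt q y y′ r) ⟩
    addAt p (x + x′) (addAt q (y + y′) r)               ∎)
    where open ≡-Reasoning

  shiftPQ-inverse : ∀ x y m → shiftPQ (- x) (- y) (shiftPQ x y m) ≡ m
  shiftPQ-inverse x y m = begin
    shiftPQ (- x) (- y) (shiftPQ x y m)  ≡⟨ shiftPQ-shiftPQ (- x) (- y) x y m ⟩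
    shiftPQ (- x + x) (- y + y) m        ≡⟨ cong₂ (λ x′ y′ → shiftPQ x′ y′ m) (ℤ.+-inverseˡ x) (ℤ.+-inverseˡ y) ⟩
    shiftPQ 0ℤ 0ℤ m                      ≡⟨ cong (_, proj₂ m) (trans (addAt-0 p _) (addAt-0 q _)) ⟩
    m                                    ∎
    where open ≡-Reasoning

  lookup-shiftPQ-p : ∀ x y (m : Margins a b c) → lookup (proj₁ (shiftPQ x y m)) p ≡ x + lookup (proj₁ m) p
  lookup-shiftPQ-p x y (r , _) = trans (lookup-addAt p x (addAt q y r)) (cong (_+_ x) (lookup-addAt-≢ p q y r p≢q))

  lookup-shiftPQ-q : ∀ x y (m : Margins a b c) → lookup (proj₁ (shiftPQ x y m)) q ≡ y + lookup (proj₁ m) q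
  lookup-shiftPQ-q x y (r , _) = trans (lookup-addAt-≢ q p x (addAt q y r) (p≢q ∘ sym)) (lookup-addAt q y r)

  place-shiftPQ : ∀ x y (cell : Cell a b c) v m → place cell v (shiftPQ x y m) ≡ shiftPQ x y (place cell v m)
  place-shiftPQ x y (i , _ , _) v (r , _) =
    cong (_, _) (sym (trans (cong (addAt p x) (addAt-comm q i y (+ v) r)) (addAt-comm p i x (+ v) _)))

  place₂₃ : Fin b → Fin c → ℕ → Margins a b c → Margins a b c
  place₂₃ j k v (r , s , t) = r , addAt j (+ v) s , addAt k (+ v) t

  place-pair : ∀ j k u w x y m →
               place (q , j , k) w (place (p , j , k) u (shiftPQ (- x) (- y) m)) ≡
               shiftPQ (- (x - + u)) (- (y - + w)) (place₂₃ j k (u +ℕ w) m)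
  place-pair j k u w x y (r , s , t) = cong₂ _,_ rows (cong₂ _,_ (column j s) (column k t))
    where
    eq : ∀ x u → u + - x ≡ - (x - u)
    eq = solve-∀
    rows : addAt q (+ w) (addAt p (+ u) (addAt p (- x) (addAt q (- y) r))) ≡
           addAt p (- (x - + u)) (addAt q (- (y - + w)) r)
    rows = begin
      addAt q (+ w) (addAt p (+ u) (addAt p (- x) (addAt q (- y) r)))
        ≡⟨ addAt-comm q p (+ w) (+ u) _ ⟩
      proj₁ (shiftPQ (+ u) (+ w) (shiftPQ (- x) (- y) (r , s , t)))
        ≡⟨ cong proj₁ (shiftPQ-shiftPQ (+ u) (+ w) (- x) (- y) (r , s , t)) ⟩
      addAt p (+ u + - x) (addAt q (+ w + - y) r)
        ≡⟨ cong₂ (λ x′ y′ → addAt p x′ (addAt q y′ r)) (eq x (+ u)) (eq y (+ w)) ⟩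
      addAt p (- (x - + u)) (addAt q (- (y - + w)) r)   ∎
      where open ≡-Reasoning
    column : ∀ {d} (j : Fin d) s → addAt j (+ w) (addAt j (+ u) s) ≡ addAt j (+ (u +ℕ w)) s
    column j s = trans (addAt-addAt j (+ w) (+ u) s) (cong (λ v → addAt j (+ v) s) (ℕ.+-comm w u))

  pairCells : List (Fin b × Fin c) → List (Cell a b c)
  pairCells []              = []
  pairCells ((j , k) ∷ jks) = (p , j , k) ∷ (q , j , k) ∷ pairCells jks

  profile : Margins a b c → List (Fin b × Fin c) → Margins a b c → ℤ → ℤ → ℕ
  profile T jks m x y = ∑fill (pairCells jks) (δ T) (shiftPQ (- x) (- y) m)

  Balanced : Margins a b c → Margins a b c → Set
  Balanced T m = lookup (proj₁ m) p - lookup (proj₁ T) p ≡ lookup (proj₁ m) q - lookup (proj₁ T) q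

  shiftPQ-hits : ∀ T m x y → Balanced T m → shiftPQ (- x) (- y) m ≡ T → x ≡ y
  shiftPQ-hits T m x y balanced hit = begin
    x                                                ≡⟨ solve x (trans (at p) (lookup-shiftPQ-p (- x) (- y) m)) ⟩
    lookup (proj₁ m) p - lookup (proj₁ T) p          ≡⟨ balanced ⟩
    lookup (proj₁ m) q - lookup (proj₁ T) q          ≡⟨ solve y (trans (at q) (lookup-shiftPQ-q (- x) (- y) m)) ⟨
    y                                                ∎
    where
    open ≡-Reasoning
    at : ∀ i → lookup (proj₁ T) i ≡ lookup (proj₁ (shiftPQ (- x) (- y) m)) i
    at i = cong (λ m′ → lookup (proj₁ m′) i) (sym hit)
    solve : ∀ z {s t} → t ≡ - z + s → z ≡ s - t
    solve z {s} t≡ = trans (eq z s) (cong (_-_ s) (sym t≡))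
      where
      eq : ∀ z s → z ≡ s - (- z + s)
      eq = solve-∀

  i+j+1≢i : ∀ y k → (y + + k) + 1ℤ ≢ y
  i+j+1≢i y k e = 1+k≢0 (trans (eq y (+ k)) (trans (cong (_- y) e) (ℤ.+-inverseʳ y)))
    where
    1+k≢0 : + suc k ≢ 0ℤ
    1+k≢0 ()
    eq : ∀ y k → 1ℤ + k ≡ ((y + k) + 1ℤ) - y
    eq = solve-∀

  -- Prepending the cells (p , j , k) and (q , j , k) convolves the profile; their entries u and w
  -- together add u + w to column j and layer k, whence the kernel depends on u + w.
  profile-unimodal : ∀ T jks m → Balanced T m → Unimodal (profile T jks m)
  profile-unimodal T [] m balanced = record { symmetric = symmetric′ ; climb = climb′ }
    where
    symmetric′ : ∀ x y → δ T (shiftPQ (- x) (- y) m) ≡ δ T (shiftPQ (- y) (- x) m)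
    symmetric′ x y with x ℤ.≟ y
    ... | yes refl = refl
    ... | no  x≢y  = trans (δ-≢ T _ (x≢y ∘ shiftPQ-hits T m x y balanced))
                           (sym (δ-≢ T _ (x≢y ∘ sym ∘ shiftPQ-hits T m y x balanced)))
    climb′ : ∀ y k → δ T (shiftPQ (- ((y + + k) + 1ℤ)) (- y) m) ≤ δ T (shiftPQ (- (y + + k)) (- (y + 1ℤ)) m)
    climb′ y k = ℕ.≤-trans (ℕ.≤-reflexive (δ-≢ T _ (i+j+1≢i y k ∘ shiftPQ-hits T m _ y balanced))) z≤n
  profile-unimodal T ((j , k) ∷ jks) m balanced =
    unimodal-resp (convolution-unimodal N G (λ v → profile-unimodal T jks (place₂₃ j k v m) balanced))
                  (λ x y → ∑-cong (suc N) (λ u → ∑-cong (suc N) (λ w →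
                     cong (∑fill (pairCells jks) (δ T)) (sym (place-pair j k u w x y m)))))
    where
    G : ℕ → ℤ → ℤ → ℕ
    G v = profile T jks (place₂₃ j k v m)

  columnsLayers : List (Fin b × Fin c)
  columnsLayers = cartesianProduct (allFin b) (allFin c)

  otherRow? : ∀ i → Dec (i ≢ p × i ≢ q)
  otherRow? i = ¬? (i Fin.≟ p) ×-dec ¬? (i Fin.≟ q)

  otherRows : List (Fin a)
  otherRows = filter otherRow? (allFin a)

  otherCells : List (Cell a b c)
  otherCells = cartesianProduct otherRows columnsLayers

  ∈-otherRows : ∀ {i} → i ∈ otherRows → i ≢ p × i ≢ q
  ∈-otherRows i∈ = proj₂ (∈-filter⁻ otherRow? {xs = allFin a} i∈)

  rowsEnumeration : IsEnumeration (otherRows ++ p ∷ q ∷ [])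
  rowsEnumeration = unique , complete
    where
    unique : Unique (otherRows ++ p ∷ q ∷ [])
    unique = Unique.++⁺ (Unique.filter⁺ otherRow? (Unique.allFin⁺ a)) ((p≢q ∷ []) ∷ [] ∷ []) disjoint
      where
      disjoint : ∀ {i} → ¬ (i ∈ otherRows × i ∈ p ∷ q ∷ [])
      disjoint (i∈ , here i≡p)         = proj₁ (∈-otherRows i∈) i≡p
      disjoint (i∈ , there (here i≡q)) = proj₂ (∈-otherRows i∈) i≡q
    complete : ∀ i → i ∈ otherRows ++ p ∷ q ∷ []
    complete i with i Fin.≟ p | i Fin.≟ q
    ... | yes i≡p | _       = ∈-++⁺ʳ otherRows (here i≡p)
    ... | no _    | yes i≡q = ∈-++⁺ʳ otherRows (there (here i≡q))
    ... | no i≢p  | no i≢q  = ∈-++⁺ˡ (∈-filter⁺ otherRow? (∈-allFin i) (i≢p , i≢q))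

  interleave : ∀ jks → map (p ,_) jks ++ map (q ,_) jks ↭ pairCells jks
  interleave []              = ↭.refl
  interleave ((j , k) ∷ jks) = ↭.prep (p , j , k) (↭.trans (↭.shift (q , j , k) (map (p ,_) jks) (map (q ,_) jks))
                                                            (↭.prep (q , j , k) (interleave jks)))

  split-enumeration : ∀ {xs} → IsEnumeration xs → xs ↭ otherCells ++ pairCells columnsLayers
  split-enumeration xs-enum = begin
    _
      ↭⟨ enumeration-↭ xs-enum cells-enum ⟩
    cartesianProduct (otherRows ++ p ∷ q ∷ []) columnsLayers
      ≡⟨ List.cartesianProductWith-distribʳ-++ _,_ otherRows _ _ ⟩
    otherCells ++ (map (p ,_) columnsLayers ++ map (q ,_) columnsLayers ++ [])
      ≡⟨ cong (λ cs → otherCells ++ (map (p ,_) columnsLayers ++ cs)) (List.++-identityʳ _) ⟩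
    otherCells ++ (map (p ,_) columnsLayers ++ map (q ,_) columnsLayers)
      ↭⟨ ↭.++⁺ˡ otherCells (interleave columnsLayers) ⟩
    otherCells ++ pairCells columnsLayers   ∎
    where
    open ↭.PermutationReasoning
    cells-enum : IsEnumeration (cartesianProduct (otherRows ++ p ∷ q ∷ []) columnsLayers)
    cells-enum =
        Unique.cartesianProduct⁺ (proj₁ rowsEnumeration) (Unique.cartesianProduct⁺ (Unique.allFin⁺ b) (Unique.allFin⁺ c))
      , λ (i , j , k) → ∈-cartesianProduct⁺ (proj₂ rowsEnumeration i) (∈-cartesianProduct⁺ (∈-allFin j) (∈-allFin k))

  RowsPQEmpty : Margins a b c → Set
  RowsPQEmpty (r , _) = lookup r p ≡ 0ℤ × lookup r q ≡ 0ℤ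

  otherCells-preserve : ∀ cell → cell ∈ otherCells → ∀ v m → RowsPQEmpty m → RowsPQEmpty (place cell v m)
  otherCells-preserve (i , _) cell∈ v (r , _) (rp≡0 , rq≡0) =
    trans (lookup-addAt-≢ p i (+ v) r (i≢p ∘ sym)) rp≡0 , trans (lookup-addAt-≢ q i (+ v) r (i≢q ∘ sym)) rq≡0
    where
    i≢p = proj₁ (∈-otherRows (proj₁ (∈-cartesianProduct⁻ otherRows columnsLayers cell∈)))
    i≢q = proj₂ (∈-otherRows (proj₁ (∈-cartesianProduct⁻ otherRows columnsLayers cell∈)))

  centre-balanced : ∀ T m → RowsPQEmpty m → Balanced T (shiftPQ (lookup (proj₁ T) p) (lookup (proj₁ T) q) m)
  centre-balanced T m (rp≡0 , rq≡0) = begin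
    lookup (proj₁ (shiftPQ Tp Tq m)) p - Tp
      ≡⟨ cong (_- Tp) (trans (lookup-shiftPQ-p Tp Tq m) (cong (_+_ Tp) rp≡0)) ⟩
    (Tp + 0ℤ) - Tp   ≡⟨ cancel Tp ⟩
    0ℤ               ≡⟨ cancel Tq ⟨
    (Tq + 0ℤ) - Tq
      ≡⟨ cong (_- Tq) (trans (lookup-shiftPQ-q Tp Tq m) (cong (_+_ Tq) rq≡0)) ⟨
    lookup (proj₁ (shiftPQ Tp Tq m)) q - Tq   ∎
    where
    open ≡-Reasoning
    Tp = lookup (proj₁ T) p
    Tq = lookup (proj₁ T) q
    cancel : ∀ u → (u + 0ℤ) - u ≡ 0ℤ
    cancel = solve-∀

  module _ (T : Margins a b c) (k : ℕ) (Tp≡ : lookup (proj₁ T) p ≡ (lookup (proj₁ T) q + + k) + 1ℤ) where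

    T′ : Margins a b c
    T′ = shiftPQ (- 1ℤ) 1ℤ T

    δT′≡δT∘shift : ∀ m → δ T′ m ≡ δ T (shiftPQ 1ℤ (- 1ℤ) m)
    δT′≡δT∘shift m = δ-cong T′ m T (shiftPQ 1ℤ (- 1ℤ) m)
      (λ m≡T′ → trans (cong (shiftPQ 1ℤ (- 1ℤ)) m≡T′) (shiftPQ-inverse (- 1ℤ) 1ℤ T))
      (λ hit → trans (sym (shiftPQ-inverse 1ℤ (- 1ℤ) m)) (cong (shiftPQ (- 1ℤ) 1ℤ) hit))

    -- Centre the pair profile at the target: with t = T q, the profile at (t + k + 1, t) is the count for
    -- target T and the profile at (t + k, t + 1) is the count for target T′, so climb compares them.
    pairCells-transfer : ∀ m → RowsPQEmpty m →
                         ∑fill (pairCells columnsLayers) (δ T) m ≤ ∑fill (pairCells columnsLayers) (δ T′) m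
    pairCells-transfer m (rp≡0 , rq≡0) = begin
      ∑fill cells (δ T) m                         ≡⟨ cong (∑fill cells (δ T)) (shiftPQ-inverse Tp t m) ⟨
      profile T jks m* Tp t                       ≡⟨ cong (λ x → profile T jks m* x t) Tp≡ ⟩
      profile T jks m* ((t + + k) + 1ℤ) t         ≤⟨ climb (profile-unimodal T jks m* balanced) t k ⟩
      profile T jks m* (t + + k) (t + 1ℤ)         ≡⟨ cong (∑fill cells (δ T)) recentre ⟩
      ∑fill cells (δ T) (shiftPQ 1ℤ (- 1ℤ) m)     ≡⟨ cong (λ xs → ∑fill xs (δ T) _) (List.map-id cells) ⟨
      ∑fill (map id cells) (δ T) (shiftPQ 1ℤ (- 1ℤ) m)
        ≡⟨ ∑fill-map id (shiftPQ 1ℤ (- 1ℤ)) (place-shiftPQ 1ℤ (- 1ℤ)) cells (δ T) m ⟩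
      ∑fill cells (δ T ∘ shiftPQ 1ℤ (- 1ℤ)) m     ≡⟨ ∑fill-cong cells δT′≡δT∘shift m ⟨
      ∑fill cells (δ T′) m                        ∎
      where
      open ℕ.≤-Reasoning
      jks = columnsLayers
      cells = pairCells jks
      t = lookup (proj₁ T) q
      Tp = lookup (proj₁ T) p
      m* = shiftPQ Tp t m
      balanced : Balanced T m*
      balanced = centre-balanced T m (rp≡0 , rq≡0)
      recentre : shiftPQ (- (t + + k)) (- (t + 1ℤ)) m* ≡ shiftPQ 1ℤ (- 1ℤ) m
      recentre = trans (shiftPQ-shiftPQ (- (t + + k)) (- (t + 1ℤ)) Tp t m)
                       (cong₂ (λ x y → shiftPQ x y m) (trans (cong (_+_ (- (t + + k))) Tp≡) (eq₁ t (+ k)))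
                                                      (eq₂ t))
        where
        eq₁ : ∀ t k → - (t + k) + ((t + k) + 1ℤ) ≡ 1ℤ
        eq₁ = solve-∀
        eq₂ : ∀ t → - (t + 1ℤ) + t ≡ - 1ℤ
        eq₂ = solve-∀

    transfer : ∀ {xs} → IsEnumeration xs → ∑fill xs (δ T) noMargins ≤ ∑fill xs (δ T′) noMargins
    transfer {xs} xs-enum = subst₂ _≤_ (sym (split (δ T))) (sym (split (δ T′)))
      (∑fill-mono RowsPQEmpty otherCells otherCells-preserve pairCells-transfer noMargins
                  (Vec.lookup-replicate p 0ℤ , Vec.lookup-replicate q 0ℤ))
      where
      split : ∀ f → ∑fill xs f noMargins ≡ ∑fill otherCells (∑fill (pairCells columnsLayers) f) noMargins
      split f = trans (∑fill-↭ (split-enumeration xs-enum) f noMargins) (∑fill-++ otherCells _ f noMargins)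

module Tables (N : ℕ) where
  open import Data.Integer using (_+_)
  open Filling N

  entries : List ℕ
  entries = upTo (suc N)

  placeRow : ∀ {a b c c′} → Fin a → Fin b → (Fin c′ → Fin c) → Vec ℕ c′ → Margins a b c → Margins a b c
  placeRow i j g []        m = m
  placeRow i j g (v ∷ row) m = placeRow i j (g ∘ suc) row (place (i , j , g zero) v m)

  rowCells : ∀ {a b c c′} → Fin a → Fin b → (Fin c′ → Fin c) → List (Cell a b c)
  rowCells {c′ = zero}  i j g = []
  rowCells {c′ = suc _} i j g = (i , j , g zero) ∷ rowCells i j (g ∘ suc)

  ∑-placeRow : ∀ {a b c} c′ (i : Fin a) (j : Fin b) (g : Fin c′ → Fin c) f m →
               ∑∈ (λ row → f (placeRow i j g row m)) (allVecs N c′) ≡ ∑fill (rowCells i j g) f m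
  ∑-placeRow zero     i j g f m = ℕ.+-identityʳ (f m)
  ∑-placeRow (suc c′) i j g f m =
    trans (∑∈-allVecsOf entries c′ _)
      (trans (∑∈-cong entries (λ v → ∑-placeRow c′ i j (g ∘ suc) f (place (i , j , g zero) v m)))
             (∑∈-applyUpTo (λ v → ∑fill (rowCells i j (g ∘ suc)) f (place (i , j , g zero) v m)) id (suc N)))

  placeSlice : ∀ {a b c b′} → Fin a → (Fin b′ → Fin b) → Vec (Vec ℕ c) b′ → Margins a b c → Margins a b c
  placeSlice i h []          m = m
  placeSlice i h (row ∷ rows) m = placeSlice i (h ∘ suc) rows (placeRow i (h zero) id row m)

  sliceCells : ∀ {a b c b′} → Fin a → (Fin b′ → Fin b) → List (Cell a b c)
  sliceCells {b′ = zero}  i h = []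
  sliceCells {b′ = suc _} i h = rowCells i (h zero) id ++ sliceCells i (h ∘ suc)

  ∑-placeSlice : ∀ {a b c} b′ (i : Fin a) (h : Fin b′ → Fin b) f m →
                 ∑∈ (λ rows → f (placeSlice i h rows m)) (allVecsOf (allVecs N c) b′) ≡ ∑fill (sliceCells i h) f m
  ∑-placeSlice zero      i h f m = ℕ.+-identityʳ (f m)
  ∑-placeSlice {c = c} (suc b′) i h f m =
    trans (∑∈-allVecsOf (allVecs N c) b′ _)
      (trans (∑∈-cong (allVecs N c) (λ row → ∑-placeSlice b′ i (h ∘ suc) f (placeRow i (h zero) id row m)))
        (trans (∑-placeRow c i (h zero) id _ m) (sym (∑fill-++ (rowCells i (h zero) id) _ f m))))

  placeTable : ∀ {a b c a′} → (Fin a′ → Fin a) → Table a′ b c → Margins a b c → Margins a b c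
  placeTable e []           m = m
  placeTable e (rows ∷ X) m = placeTable (e ∘ suc) X (placeSlice (e zero) id rows m)

  tableCells : ∀ {a b c a′} → (Fin a′ → Fin a) → List (Cell a b c)
  tableCells {a′ = zero}  e = []
  tableCells {a′ = suc _} e = sliceCells (e zero) id ++ tableCells (e ∘ suc)

  ∑-placeTable : ∀ {a b c} a′ (e : Fin a′ → Fin a) f m →
                 ∑∈ (λ X → f (placeTable e X m)) (allTables N a′ b c) ≡ ∑fill (tableCells e) f m
  ∑-placeTable zero     e f m = ℕ.+-identityʳ (f m)
  ∑-placeTable {b = b} {c} (suc a′) e f m =
    trans (∑∈-allVecsOf (allVecsOf (allVecs N c) b) a′ _)
      (trans (∑∈-cong (allVecsOf (allVecs N c) b)
                      (λ rows → ∑-placeTable a′ (e ∘ suc) f (placeSlice (e zero) id rows m)))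
        (trans (∑-placeSlice b (e zero) id _ m) (sym (∑fill-++ (sliceCells (e zero) id) _ f m))))

  rowCells≡ : ∀ {a b c c′} (i : Fin a) (j : Fin b) (g : Fin c′ → Fin c) →
              rowCells i j g ≡ map (λ k → i , j , k) (tabulate g)
  rowCells≡ {c′ = zero}  i j g = refl
  rowCells≡ {c′ = suc _} i j g = cong ((i , j , g zero) ∷_) (rowCells≡ i j (g ∘ suc))

  sliceCells≡ : ∀ {a b c b′} (i : Fin a) (h : Fin b′ → Fin b) →
                sliceCells {c = c} i h ≡ map (i ,_) (cartesianProduct (tabulate h) (allFin c))
  sliceCells≡ {b′ = zero}        i h = refl
  sliceCells≡ {c = c} {suc _} i h =
    trans (cong₂ _++_ (trans (rowCells≡ i (h zero) id) (List.map-∘ (allFin c))) (sliceCells≡ i (h ∘ suc)))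
          (sym (List.map-++ (i ,_) (map (h zero ,_) (allFin c)) _))

  tableCells≡ : ∀ {a b c a′} (e : Fin a′ → Fin a) →
                tableCells {b = b} {c = c} e ≡ cartesianProduct (tabulate e) (cartesianProduct (allFin b) (allFin c))
  tableCells≡ {a′ = zero}  e = refl
  tableCells≡ {a′ = suc _} e = cong₂ _++_ (sliceCells≡ (e zero) id) (tableCells≡ (e ∘ suc))

  allCells : ∀ a b c → List (Cell a b c)
  allCells a b c = tableCells id

  allCells-enumeration : ∀ a b c → IsEnumeration (allCells a b c)
  allCells-enumeration a b c rewrite tableCells≡ {b = b} {c = c} (id {A = Fin a}) =
      Unique.cartesianProduct⁺ (Unique.allFin⁺ a) (Unique.cartesianProduct⁺ (Unique.allFin⁺ b) (Unique.allFin⁺ c))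
    , λ (i , j , k) → ∈-cartesianProduct⁺ (∈-allFin i) (∈-cartesianProduct⁺ (∈-allFin j) (∈-allFin k))

  placeRow-cons₁ : ∀ {a b c c′} (i : Fin a) (j : Fin b) (g : Fin c′ → Fin c) row x m →
                   placeRow (suc i) j g row (cons₁ x m) ≡ cons₁ x (placeRow i j g row m)
  placeRow-cons₁ i j g []        x m = refl
  placeRow-cons₁ i j g (v ∷ row) x m = placeRow-cons₁ i j (g ∘ suc) row x _

  placeRow-cons₂ : ∀ {a b c c′} (i : Fin a) (j : Fin b) (g : Fin c′ → Fin c) row x m →
                   placeRow i (suc j) g row (cons₂ x m) ≡ cons₂ x (placeRow i j g row m)
  placeRow-cons₂ i j g []        x m = refl
  placeRow-cons₂ i j g (v ∷ row) x m = placeRow-cons₂ i j (g ∘ suc) row x _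

  placeRow-cons₃ : ∀ {a b c c′} (i : Fin a) (j : Fin b) (g : Fin c′ → Fin c) row x m →
                   placeRow i j (suc ∘ g) row (cons₃ x m) ≡ cons₃ x (placeRow i j g row m)
  placeRow-cons₃ i j g []        x m = refl
  placeRow-cons₃ i j g (v ∷ row) x m = placeRow-cons₃ i j (g ∘ suc) row x _

  placeSlice-cons₁ : ∀ {a b c b′} (i : Fin a) (h : Fin b′ → Fin b) (rows : Vec (Vec ℕ c) b′) x m →
                     placeSlice (suc i) h rows (cons₁ x m) ≡ cons₁ x (placeSlice i h rows m)
  placeSlice-cons₁ i h []           x m = refl
  placeSlice-cons₁ i h (row ∷ rows) x m =
    trans (cong (placeSlice (suc i) (h ∘ suc) rows) (placeRow-cons₁ i (h zero) id row x m))
          (placeSlice-cons₁ i (h ∘ suc) rows x _)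

  placeSlice-cons₂ : ∀ {a b c b′} (i : Fin a) (h : Fin b′ → Fin b) (rows : Vec (Vec ℕ c) b′) x m →
                     placeSlice i (suc ∘ h) rows (cons₂ x m) ≡ cons₂ x (placeSlice i h rows m)
  placeSlice-cons₂ i h []           x m = refl
  placeSlice-cons₂ i h (row ∷ rows) x m =
    trans (cong (placeSlice i (suc ∘ h ∘ suc) rows) (placeRow-cons₂ i (h zero) id row x m))
          (placeSlice-cons₂ i (h ∘ suc) rows x _)

  placeTable-cons₁ : ∀ {a b c a′} (e : Fin a′ → Fin a) (X : Table a′ b c) x m →
                     placeTable (suc ∘ e) X (cons₁ x m) ≡ cons₁ x (placeTable e X m)
  placeTable-cons₁ e []         x m = refl
  placeTable-cons₁ e (rows ∷ X) x m =
    trans (cong (placeTable (suc ∘ e ∘ suc) X) (placeSlice-cons₁ (e zero) id rows x m))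
          (placeTable-cons₁ (e ∘ suc) X x _)

  placeRow-margins : ∀ {a b c} (i : Fin a) (j : Fin b) (row : Vec ℕ c) (m : Margins a b c) →
                     placeRow i j id row m ≡
                     (addAt i (+ vsum row) (proj₁ m) , addAt j (+ vsum row) (proj₁ (proj₂ m)) , proj₂ (proj₂ m) ⊕ row)
  placeRow-margins i j []        (r , s , []) = sym (cong₂ _,_ (addAt-0 i r) (cong (_, []) (addAt-0 j s)))
  placeRow-margins i j (v ∷ row) (r , s , t₀ ∷ t) = begin
    placeRow i j suc row (addAt i (+ v) r , addAt j (+ v) s , (+ v + t₀) ∷ t)
      ≡⟨ placeRow-cons₃ i j id row (+ v + t₀) (addAt i (+ v) r , addAt j (+ v) s , t) ⟩
    cons₃ (+ v + t₀) (placeRow i j id row (addAt i (+ v) r , addAt j (+ v) s , t))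
      ≡⟨ cong (cons₃ (+ v + t₀)) (placeRow-margins i j row _) ⟩
    cons₃ (+ v + t₀) (addAt i (+ vsum row) (addAt i (+ v) r) , addAt j (+ vsum row) (addAt j (+ v) s) , t ⊕ row)
      ≡⟨ cong₂ (λ r′ s′ → r′ , s′ , (+ v + t₀) ∷ (t ⊕ row)) (merge i r) (merge j s) ⟩
    addAt i (+ (v +ℕ vsum row)) r , addAt j (+ (v +ℕ vsum row)) s , (+ v + t₀) ∷ (t ⊕ row)
      ≡⟨ cong (λ x → _ , _ , x ∷ (t ⊕ row)) (ℤ.+-comm (+ v) t₀) ⟩
    addAt i (+ (v +ℕ vsum row)) r , addAt j (+ (v +ℕ vsum row)) s , (t₀ + + v) ∷ (t ⊕ row)  ∎
    where
    open ≡-Reasoning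
    merge : ∀ {d} (k : Fin d) w → addAt k (+ vsum row) (addAt k (+ v) w) ≡ addAt k (+ (v +ℕ vsum row)) w
    merge k w = trans (addAt-addAt k (+ vsum row) (+ v) w) (cong (λ z → addAt k (+ z) w) (ℕ.+-comm (vsum row) v))

  placeSlice-margins : ∀ {a b c} (i : Fin a) (rows : Vec (Vec ℕ c) b) (m : Margins a b c) →
                       placeSlice i id rows m ≡
                       ( addAt i (+ vsum (V.map vsum rows)) (proj₁ m)
                       , proj₁ (proj₂ m) ⊕ V.map vsum rows
                       , proj₂ (proj₂ m) ⊕ sliceSum rows)
  placeSlice-margins i []           (r , [] , t) = sym (cong₂ _,_ (addAt-0 i r) (cong ([] ,_) (⊕-identityʳ t)))
  placeSlice-margins i (row ∷ rows) (r , s₀ ∷ s , t) = begin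
    placeSlice i suc rows (placeRow i zero id row (r , s₀ ∷ s , t))
      ≡⟨ cong (placeSlice i suc rows) (placeRow-margins i zero row (r , s₀ ∷ s , t)) ⟩
    placeSlice i suc rows (cons₂ (+ vsum row + s₀) m′)
      ≡⟨ placeSlice-cons₂ i id rows (+ vsum row + s₀) m′ ⟩
    cons₂ (+ vsum row + s₀) (placeSlice i id rows m′)
      ≡⟨ cong (cons₂ (+ vsum row + s₀)) (placeSlice-margins i rows m′) ⟩
    cons₂ (+ vsum row + s₀) (addAt i (+ Σrows) (addAt i (+ vsum row) r) , s ⊕ V.map vsum rows , t ⊕ row ⊕ sliceSum rows)
      ≡⟨ cong₂ _,_ merge (cong₂ _,_ (cong (_∷ (s ⊕ V.map vsum rows)) (ℤ.+-comm (+ vsum row) s₀))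
                                    (⊕-assoc t row (sliceSum rows))) ⟩
    addAt i (+ (vsum row +ℕ Σrows)) r , (s₀ + + vsum row) ∷ (s ⊕ V.map vsum rows) , t ⊕ vadd row (sliceSum rows)  ∎
    where
    open ≡-Reasoning
    Σrows = vsum (V.map vsum rows)
    m′ = addAt i (+ vsum row) r , s , t ⊕ row
    merge : addAt i (+ Σrows) (addAt i (+ vsum row) r) ≡ addAt i (+ (vsum row +ℕ Σrows)) r
    merge = trans (addAt-addAt i (+ Σrows) (+ vsum row) r) (cong (λ z → addAt i (+ z) r) (ℕ.+-comm Σrows (vsum row)))

  placeTable-margins : ∀ {a b c} (X : Table a b c) (m : Margins a b c) →
                       placeTable id X m ≡
                       (proj₁ m ⊕ margin₁ X , proj₁ (proj₂ m) ⊕ margin₂ X , proj₂ (proj₂ m) ⊕ margin₃ X)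
  placeTable-margins []         ([] , s , t)     = sym (cong ([] ,_) (cong₂ _,_ (⊕-identityʳ s) (⊕-identityʳ t)))
  placeTable-margins (rows ∷ X) (r₀ ∷ r , s , t) = begin
    placeTable suc X (placeSlice zero id rows (r₀ ∷ r , s , t))
      ≡⟨ cong (placeTable suc X) (placeSlice-margins zero rows (r₀ ∷ r , s , t)) ⟩
    placeTable suc X (cons₁ x m′)
      ≡⟨ placeTable-cons₁ id X x m′ ⟩
    cons₁ x (placeTable id X m′)
      ≡⟨ cong (cons₁ x) (placeTable-margins X m′) ⟩
    cons₁ x (r ⊕ margin₁ X , s ⊕ V.map vsum rows ⊕ margin₂ X , t ⊕ sliceSum rows ⊕ margin₃ X)
      ≡⟨ cong₂ _,_ (cong (_∷ (r ⊕ margin₁ X)) (ℤ.+-comm _ r₀)) (cong₂ _,_ (⊕-assoc s _ _) (⊕-assoc t _ _)) ⟩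
    (r₀ ∷ r) ⊕ margin₁ (rows ∷ X) , s ⊕ margin₂ (rows ∷ X) , t ⊕ margin₃ (rows ∷ X)  ∎
    where
    open ≡-Reasoning
    x = + vsum (V.map vsum rows) + r₀
    m′ = r , s ⊕ V.map vsum rows , t ⊕ sliceSum rows

  count≡∑fill : ∀ a b c (r : Vec ℕ a) (s : Vec ℕ b) (t : Vec ℕ c) →
                length (filter (hasMargins? r s t) (allTables N a b c)) ≡
                ∑fill (allCells a b c) (δ (toℤ r , toℤ s , toℤ t)) noMargins
  count≡∑fill a b c r s t = begin
    length (filter (hasMargins? r s t) tables)         ≡⟨ length-filter (hasMargins? r s t) tables ⟩
    ∑∈ (iverson ∘ hasMargins? r s t) tables            ≡⟨ ∑∈-cong tables indicator ⟩
    ∑∈ (δ target ∘ λ X → placeTable id X noMargins) tables  ≡⟨ ∑-placeTable a id (δ target) noMargins ⟩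
    ∑fill (allCells a b c) (δ target) noMargins        ∎
    where
    open ≡-Reasoning
    tables = allTables N a b c
    target = toℤ r , toℤ s , toℤ t
    placed : ∀ X → placeTable id X noMargins ≡ (toℤ (margin₁ X) , toℤ (margin₂ X) , toℤ (margin₃ X))
    placed X = trans (placeTable-margins X noMargins) (cong₂ _,_ (0⊕ _) (cong₂ _,_ (0⊕ _) (0⊕ _)))
    indicator : ∀ X → iverson (hasMargins? r s t X) ≡ δ target (placeTable id X noMargins)
    indicator X = iverson-cong _ _
      (λ ((e₁ , e₂) , e₃) → trans (placed X) (cong₂ _,_ (cong toℤ e₁) (cong₂ _,_ (cong toℤ e₂) (cong toℤ e₃))))
      (λ hit → let e = trans (sym (placed X)) hit in
          (toℤ-injective _ _ (cong proj₁ e) , toℤ-injective _ _ (cong (proj₁ ∘ proj₂) e))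
        , toℤ-injective _ _ (cong (proj₂ ∘ proj₂) e))

module Dominance where
  open import Data.Nat using (_+_)
  open import Data.Nat.Tactic.RingSolver using (solve-∀)

  data _⇝_ {a} : Vec ℕ a → Vec ℕ a → Set where
    done : ∀ {v} → v ⇝ v
    step : ∀ {v w} (p q : Fin a) → lookup v q < lookup v p → move p q v ⇝ w → v ⇝ w

  ⇝-mono : ∀ {a} (P : Vec ℕ a → ℕ) → (∀ v p q → lookup v q < lookup v p → P v ≤ P (move p q v)) →
           ∀ {v w} → v ⇝ w → P v ≤ P w
  ⇝-mono P P-move done                = ℕ.≤-refl
  ⇝-mono P P-move (step p q vq<vp v⇝w) = ℕ.≤-trans (P-move _ p q vq<vp) (⇝-mono P P-move v⇝w)

  ∷-⇝ : ∀ {a} x {v w : Vec ℕ a} → v ⇝ w → (x ∷ v) ⇝ (x ∷ w)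
  ∷-⇝ x done                 = done
  ∷-⇝ x (step p q vq<vp v⇝w) = step (suc p) (suc q) vq<vp (∷-⇝ x v⇝w)

  prefixSum : ∀ {a} → ℕ → Vec ℕ a → ℕ
  prefixSum i v = sum (take i (toList v))

  _⊵ᵛ_ : ∀ {a} → Vec ℕ a → Vec ℕ a → Set
  v ⊵ᵛ w = ∀ i → prefixSum i w ≤ prefixSum i v

  ≥-head : ∀ {a} z (y : Vec ℕ a) → Linked _≥_ (z ∷ toList y) → ∀ l → lookup y l ≤ z
  ≥-head z (_ ∷ y) (z≥ ∷ y↘) zero    = z≥
  ≥-head z (_ ∷ y) (z≥ ∷ y↘) (suc l) = ℕ.≤-trans (≥-head _ y y↘ l) z≥

  sum-inc : ∀ {a} (l : Fin a) (v : Vec ℕ a) → sum (toList (updateAt v l suc)) ≡ suc (sum (toList v))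
  sum-inc zero    (x ∷ v) = refl
  sum-inc (suc l) (x ∷ v) = trans (cong (_+_ x) (sum-inc l v)) (ℕ.+-suc x _)

  prefixSum-inc-≤ : ∀ {a} (l : Fin a) (v : Vec ℕ a) i → i ≤ toℕ l →
                    prefixSum i (updateAt v l suc) ≡ prefixSum i v
  prefixSum-inc-≤ l       v       zero    _         = refl
  prefixSum-inc-≤ (suc l) (x ∷ v) (suc i) (s≤s i≤l) = cong (_+_ x) (prefixSum-inc-≤ l v i i≤l)

  prefixSum-inc-> : ∀ {a} (l : Fin a) (v : Vec ℕ a) i → toℕ l < i →
                    prefixSum i (updateAt v l suc) ≡ suc (prefixSum i v)
  prefixSum-inc-> zero    (x ∷ v) (suc i) _         = refl
  prefixSum-inc-> (suc l) (x ∷ v) (suc i) (s≤s l<i) = trans (cong (_+_ x) (prefixSum-inc-> l v i l<i)) (ℕ.+-suc x _)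

  first-deficit : ∀ {a} c (v y : Vec ℕ a) → 1 ≤ c → c + sum (toList v) ≡ sum (toList y) →
                  ∃[ l ] lookup v l < lookup y l × (∀ i → i ≤ toℕ l → 1 + prefixSum i y ≤ c + prefixSum i v)
  first-deficit c []      []      1≤c c+0≡0 = ⊥-elim (ℕ.<-irrefl refl (ℕ.≤-trans 1≤c (ℕ.≤-reflexive c≡0)))
    where
    c≡0 : c ≡ 0
    c≡0 = trans (sym (ℕ.+-identityʳ c)) c+0≡0
  first-deficit c (w ∷ v) (z ∷ y) 1≤c sums with w <? z
  ... | yes w<z = zero , w<z , λ { zero _ → ℕ.≤-trans 1≤c (ℕ.≤-reflexive (sym (ℕ.+-identityʳ c))) }
  ... | no  w≮z = suc l , vl<yl , prefix
    where
    d = w ∸ z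
    w≡z+d : w ≡ z + d
    w≡z+d = sym (ℕ.m+[n∸m]≡n (ℕ.≮⇒≥ w≮z))
    sums′ : (c + d) + sum (toList v) ≡ sum (toList y)
    sums′ = ℕ.+-cancelˡ-≡ z _ _ (trans (eq z c d _)
                                       (trans (cong (λ t → c + (t + sum (toList v))) (sym w≡z+d)) sums))
      where
      eq : ∀ z c d s → z + ((c + d) + s) ≡ c + ((z + d) + s)
      eq = solve-∀
    rec = first-deficit (c + d) v y (ℕ.≤-trans 1≤c (ℕ.m≤m+n c d)) sums′
    l = proj₁ rec
    vl<yl = proj₁ (proj₂ rec)
    prefix : ∀ i → i ≤ toℕ (suc l) → 1 + prefixSum i (z ∷ y) ≤ c + prefixSum i (w ∷ v)
    prefix zero    _         = ℕ.≤-trans 1≤c (ℕ.≤-reflexive (sym (ℕ.+-identityʳ c)))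
    prefix (suc i) (s≤s i≤l) = subst₂ _≤_ (eq₁ z (prefixSum i y))
                                          (trans (eq₂ z c d (prefixSum i v)) (cong (λ t → c + (t + prefixSum i v)) (sym w≡z+d)))
                                          (ℕ.+-monoʳ-≤ z (proj₂ (proj₂ rec) i i≤l))
      where
      eq₁ : ∀ z p → z + (1 + p) ≡ 1 + (z + p)
      eq₁ = solve-∀
      eq₂ : ∀ z c d p → z + ((c + d) + p) ≡ c + ((z + d) + p)
      eq₂ = solve-∀

  mutual
    dominance⇒⇝ : ∀ {a} (v y : Vec ℕ a) → v ⊵ᵛ y → Linked _≥_ (toList y) →
                  sum (toList v) ≡ sum (toList y) → v ⇝ y
    dominance⇒⇝ []      []      _   _  _    = done
    dominance⇒⇝ (x ∷ v) (z ∷ y) dom y↘ sums = subst (λ x → (x ∷ v) ⇝ (z ∷ y)) x∸z+z≡x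
      (excess⇒⇝ (x ∸ z) z v y (subst (λ x → (x ∷ v) ⊵ᵛ (z ∷ y)) (sym x∸z+z≡x) dom) y↘
                               (subst (λ x → x + sum (toList v) ≡ _) (sym x∸z+z≡x) sums))
      where
      x∸z+z≡x : x ∸ z + z ≡ x
      x∸z+z≡x = ℕ.m∸n+n≡m (subst₂ _≤_ (ℕ.+-identityʳ z) (ℕ.+-identityʳ x) (dom 1))

    excess⇒⇝ : ∀ {a} k z (v y : Vec ℕ a) → ((k + z) ∷ v) ⊵ᵛ (z ∷ y) → Linked _≥_ (z ∷ toList y) →
               (k + z) + sum (toList v) ≡ z + sum (toList y) → ((k + z) ∷ v) ⇝ (z ∷ y)
    excess⇒⇝ zero    z v y dom y↘ sums =
      ∷-⇝ z (dominance⇒⇝ v y (λ i → ℕ.+-cancelˡ-≤ z _ _ (dom (suc i))) (Linked.tail y↘)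
                             (ℕ.+-cancelˡ-≡ z _ _ sums))
    excess⇒⇝ (suc k) z v y dom y↘ sums =
      step zero (suc l) vl<x (excess⇒⇝ k z (updateAt v l suc) y dom′ y↘ sums′)
      where
      deficit = first-deficit (suc k) v y (s≤s z≤n) (ℕ.+-cancelˡ-≡ z _ _ (trans (eq z k (sum (toList v))) sums))
        where
        eq : ∀ z k s → z + ((1 + k) + s) ≡ ((1 + k) + z) + s
        eq = solve-∀
      l = proj₁ deficit
      vl<x : lookup v l < suc k + z
      vl<x = ℕ.<-≤-trans (proj₁ (proj₂ deficit)) (ℕ.≤-trans (≥-head z y y↘ l) (ℕ.m≤n+m z (suc k)))
      sums′ : (k + z) + sum (toList (updateAt v l suc)) ≡ z + sum (toList y)
      sums′ = trans (cong (_+_ (k + z)) (sum-inc l v)) (trans (ℕ.+-suc (k + z) _) sums)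
      dom′ : ((k + z) ∷ updateAt v l suc) ⊵ᵛ (z ∷ y)
      dom′ zero    = z≤n
      dom′ (suc i) with i ≤? toℕ l
      ... | yes i≤l = begin
        z + prefixSum i y                           ≤⟨ ℕ.+-monoʳ-≤ z (ℕ.≤-pred (proj₂ (proj₂ deficit) i i≤l)) ⟩
        z + (k + prefixSum i v)                     ≡⟨ eq z k (prefixSum i v) ⟩
        (k + z) + prefixSum i v                     ≡⟨ cong (_+_ (k + z)) (prefixSum-inc-≤ l v i i≤l) ⟨
        (k + z) + prefixSum i (updateAt v l suc)    ∎
        where
        open ℕ.≤-Reasoning
        eq : ∀ z k p → z + (k + p) ≡ (k + z) + p
        eq = solve-∀
      ... | no  i≰l = begin
        z + prefixSum i y                           ≤⟨ dom (suc i) ⟩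
        suc (k + z) + prefixSum i v                 ≡⟨ ℕ.+-suc (k + z) _ ⟨
        (k + z) + suc (prefixSum i v)               ≡⟨ cong (_+_ (k + z)) (prefixSum-inc-> l v i (ℕ.≰⇒> i≰l)) ⟨
        (k + z) + prefixSum i (updateAt v l suc)    ∎
        where open ℕ.≤-Reasoning

open Dominance

subst-invariant : ∀ {B : Set} (f : ∀ {a} → Vec ℕ a → B) {a a′} (e : a ≡ a′) (w : Vec ℕ a) →
                  f (subst (Vec ℕ) e w) ≡ f w
subst-invariant f refl w = refl

module Counting (N : ℕ) where
  open import Data.Integer using (_+_)
  open Filling N
  open Tables N

  #tables : ∀ {a b c} → Vec ℕ a → Vec ℕ b → Vec ℕ c → ℕ
  #tables {a} {b} {c} r s t = ∑fill (allCells a b c) (δ (toℤ r , toℤ s , toℤ t)) noMargins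

  #tables-transfer : ∀ {a b c} (r : Vec ℕ a) (s : Vec ℕ b) (t : Vec ℕ c) (p q : Fin a) →
                     lookup r q < lookup r p → #tables r s t ≤ #tables (move p q r) s t
  #tables-transfer {a} {b} {c} r s t p q rq<rp =
    subst (λ r′ → #tables r s t ≤ ∑fill (allCells a b c) (δ (r′ , toℤ s , toℤ t)) noMargins)
          (sym (toℤ-move p q r (ℕ.≤-trans (s≤s z≤n) rq<rp)))
          (Transfer.transfer N p q p≢q (toℤ r , toℤ s , toℤ t) k Tp≡ (allCells-enumeration a b c))
    where
    p≢q : p ≢ q
    p≢q refl = ℕ.<-irrefl refl rq<rp
    k = proj₁ (ℕ.m≤n⇒∃[o]m+o≡n rq<rp)
    Tp≡ : lookup (toℤ r) p ≡ (lookup (toℤ r) q + + k) + 1ℤ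
    Tp≡ = begin
      lookup (toℤ r) p               ≡⟨ Vec.lookup-map p +_ r ⟩
      + lookup r p                   ≡⟨ cong +_ (trans (sym (proj₂ (ℕ.m≤n⇒∃[o]m+o≡n rq<rp))) (ℕ.+-comm 1 _)) ⟩
      + (lookup r q +ℕ k +ℕ 1)       ≡⟨ cong (λ z → (z + + k) + 1ℤ) (Vec.lookup-map q +_ r) ⟨
      (lookup (toℤ r) q + + k) + 1ℤ  ∎
      where open ≡-Reasoning

  ∑fill-δ-relabel : ∀ {a b c a′ b′ c′}
                    (σ : Cell a b c → Cell a′ b′ c′) (σ⁻¹ : Cell a′ b′ c′ → Cell a b c) →
                    (∀ x → σ⁻¹ (σ x) ≡ x) → (∀ y → σ (σ⁻¹ y) ≡ y) →
                    (g : Margins a b c → Margins a′ b′ c′) →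
                    (∀ x v m → place (σ x) v (g m) ≡ g (place x v m)) →
                    (∀ {m m′} → g m ≡ g m′ → m ≡ m′) → g noMargins ≡ noMargins →
                    ∀ T → ∑fill (allCells a′ b′ c′) (δ (g T)) noMargins ≡
                          ∑fill (allCells a b c) (δ T) noMargins
  ∑fill-δ-relabel {a} {b} {c} {a′} {b′} {c′} σ σ⁻¹ σ⁻¹σ σσ⁻¹ g place-σ g-injective g0≡0 T = begin
    ∑fill cells′ (δ (g T)) noMargins          ≡⟨ cong (∑fill cells′ (δ (g T))) g0≡0 ⟨
    ∑fill cells′ (δ (g T)) (g noMargins)      ≡⟨ ∑fill-↭ (enumeration-↭ cells′-enum σ-cells) _ _ ⟩
    ∑fill (map σ cells) (δ (g T)) (g noMargins)  ≡⟨ ∑fill-map σ g place-σ cells (δ (g T)) noMargins ⟩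
    ∑fill cells (δ (g T) ∘ g) noMargins       ≡⟨ ∑fill-cong cells (λ m → δ-cong (g T) (g m) T m g-injective (cong g)) _ ⟩
    ∑fill cells (δ T) noMargins               ∎
    where
    open ≡-Reasoning
    cells = allCells a b c
    cells′ = allCells a′ b′ c′
    cells′-enum = allCells-enumeration a′ b′ c′
    σ-cells = map-enumeration σ σ⁻¹ σ⁻¹σ σσ⁻¹ (allCells-enumeration a b c)

  #tables-swap₁₂ : ∀ {a b c} (r : Vec ℕ a) (s : Vec ℕ b) (t : Vec ℕ c) → #tables r s t ≡ #tables s r t
  #tables-swap₁₂ {a} {b} {c} r s t =
    sym (∑fill-δ-relabel {a} {b} {c} swap₁₂ swap₁₂ (λ _ → refl) (λ _ → refl) swap₁₂ (λ _ _ _ → refl)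
                         (cong swap₁₂) refl (toℤ r , toℤ s , toℤ t))

  #tables-swap₁₃ : ∀ {a b c} (r : Vec ℕ a) (s : Vec ℕ b) (t : Vec ℕ c) → #tables r s t ≡ #tables t s r
  #tables-swap₁₃ {a} {b} {c} r s t =
    sym (∑fill-δ-relabel {a} {b} {c} swap₁₃ swap₁₃ (λ _ → refl) (λ _ → refl) swap₁₃ (λ _ _ _ → refl)
                         (cong swap₁₃) refl (toℤ r , toℤ s , toℤ t))

  #tables-dominance : ∀ (xs ys : List ℕ) → length xs ≡ length ys → (∀ i → sum (take i xs) ≥ sum (take i ys)) →
                      Linked _≥_ ys → sum xs ≡ sum ys →
                      ∀ {b c} (s : Vec ℕ b) (t : Vec ℕ c) → #tables (fromList xs) s t ≤ #tables (fromList ys) s t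
  #tables-dominance xs ys e xs⊵ys ys↘ sums s t = begin
    #tables v s t   ≤⟨ ⇝-mono (λ r → #tables r s t) (λ r → #tables-transfer r s t)
                              (dominance⇒⇝ v w dom ys↘′ sums′) ⟩
    #tables w s t   ≡⟨ subst-invariant (λ r → #tables r s t) (sym e) (fromList ys) ⟩
    #tables (fromList ys) s t ∎
    where
    open ℕ.≤-Reasoning
    v = fromList xs
    w = subst (Vec ℕ) (sym e) (fromList ys)
    toList-v : toList v ≡ xs
    toList-v = Vec.toList∘fromList xs
    toList-w : toList w ≡ ys
    toList-w = trans (subst-invariant toList (sym e) (fromList ys)) (Vec.toList∘fromList ys)
    dom : v ⊵ᵛ w
    dom i = subst₂ (λ ys′ xs′ → sum (take i ys′) ≤ sum (take i xs′)) (sym toList-w) (sym toList-v) (xs⊵ys i)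
    ys↘′ : Linked _≥_ (toList w)
    ys↘′ = subst (Linked _≥_) (sym toList-w) ys↘
    sums′ : sum (toList v) ≡ sum (toList w)
    sums′ = subst₂ (λ xs′ ys′ → sum xs′ ≡ sum ys′) (sym toList-v) (sym toList-w) sums

module _ {n : ℕ} where
  open Counting n
  open Tables n

  partsVec : (lam : Partition n) → Vec ℕ (ℓ lam)
  partsVec lam = fromList (parts lam)

  T≡#tables : (lam mu nu : Partition n) → T lam mu nu ≡ #tables (partsVec lam) (partsVec mu) (partsVec nu)
  T≡#tables lam mu nu = count≡∑fill _ _ _ (partsVec lam) (partsVec mu) (partsVec nu)

  T-swap₁₂ : (lam mu nu : Partition n) → T lam mu nu ≡ T mu lam nu
  T-swap₁₂ lam mu nu = trans (T≡#tables lam mu nu)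
    (trans (#tables-swap₁₂ (partsVec lam) (partsVec mu) (partsVec nu)) (sym (T≡#tables mu lam nu)))

  T-swap₁₃ : (lam mu nu : Partition n) → T lam mu nu ≡ T nu mu lam
  T-swap₁₃ lam mu nu = trans (T≡#tables lam mu nu)
    (trans (#tables-swap₁₃ (partsVec lam) (partsVec mu) (partsVec nu)) (sym (T≡#tables nu mu lam)))

  T-dominance : (lam alp mu nu : Partition n) → ℓ lam ≡ ℓ alp → lam ⊵ alp → T lam mu nu ≤ T alp mu nu
  T-dominance lam alp mu nu e lam⊵alp = subst₂ _≤_ (sym (T≡#tables lam mu nu)) (sym (T≡#tables alp mu nu))
    (#tables-dominance (parts lam) (parts alp) e lam⊵alp (decr alp) (trans (total lam) (sym (total alp)))
                       (partsVec mu) (partsVec nu))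

theorem3p10 : (n : ℕ) (lam mu nu alp bet gam : Partition n) →
              ℓ lam ≡ ℓ alp → ℓ mu ≡ ℓ bet → ℓ nu ≡ ℓ gam →
              lam ⊵ alp → mu ⊵ bet → nu ⊵ gam →
              T lam mu nu ≤ T alp bet gam
theorem3p10 n lam mu nu alp bet gam ℓ₁ ℓ₂ ℓ₃ lam⊵alp mu⊵bet nu⊵gam = begin
  T lam mu nu    ≤⟨ T-dominance lam alp mu nu ℓ₁ lam⊵alp ⟩
  T alp mu nu    ≡⟨ T-swap₁₂ alp mu nu ⟩
  T mu alp nu    ≤⟨ T-dominance mu bet alp nu ℓ₂ mu⊵bet ⟩
  T bet alp nu   ≡⟨ T-swap₁₂ bet alp nu ⟩
  T alp bet nu   ≡⟨ T-swap₁₃ alp bet nu ⟩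
  T nu bet alp   ≤⟨ T-dominance nu gam bet alp ℓ₃ nu⊵gam ⟩
  T gam bet alp  ≡⟨ T-swap₁₃ gam bet alp ⟩
  T alp bet gam  ∎
  where open ℕ.≤-Reasoning
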